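{- Let $G_\sigma$ be a sign-connected signed graph. If the underlying graph of $G_\sigma$ is a block and $G_\sigma$ contains two vertex-disjoint negative cycles, then $G_\sigma$ is a sign block.
   Context: A signed graph consists of a finite undirected graph, in which loops and multiple edges are allowed, with a sign $\pm1$ on each edge. Cycles are elementary; a loop is a cycle of length 1. Chains are walks. Signs of cycles and chains are products of their edge signs, counted with multiplicity. Vertices $u,v$ are sign connected if $u=v$ or both a positive and a negative chain join them. The signed graph is sign connected if every two vertices are sign connected. For a sign-connected $G_\sigma$, a vertex $x$ is a sign articulation vertex if $G_\sigma-x$ is not sign connected. A sign-connected $G_\sigma$ is a sign block if it has no sign articulation vertex. An articulation vertex is a vertex $v$ for which there exist edges $e,f$ such that every chain from $e$ to $f$ passes through $v$. A vertex supporting a loop is an articulation vertex unless it is incident with no other edge. A graph is a block if it has no articulation vertex. -}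

module Defs where

open import Data.Nat using (ℕ)
open import Data.Fin using (Fin)
open import Data.Bool using (Bool; true; false; _xor_)
open import Data.Product using (Σ; ∃; _×_; _,_)
open import Data.Sum using (_⊎_)
open import Data.Maybe using (Maybe; just)
open import Data.List using (List; []; _∷_; map; foldr; head; last)
open import Data.List.Membership.Propositional using (_∈_; _∉_)
open import Data.List.Relation.Unary.Unique.Propositional using (Unique)
open import Relation.Binary.PropositionalEquality using (_≡_; _≢_)
open import Relation.Nullary using (¬_)

-- A finite signed graph: vertices Fin nV, edges Fin nE (loops and multiple
-- edges allowed); each edge has two (possibly equal) endpoints and a sign,
-- where negative e ≡ true means sign −1.
record SignedGraph : Set where
  field
    nV nE     : ℕ
    endpoints : Fin nE → Fin nV × Fin nV
    negative  : Fin nE → Bool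

open SignedGraph public

Vertex : SignedGraph → Set
Vertex G = Fin (nV G)

Edge : SignedGraph → Set
Edge G = Fin (nE G)

Joins : (G : SignedGraph) → Edge G → Vertex G → Vertex G → Set
Joins G e u w = (endpoints G e ≡ (u , w)) ⊎ (endpoints G e ≡ (w , u))

data Walk (G : SignedGraph) : Vertex G → Vertex G → Set where
  []   : ∀ {v} → Walk G v v
  step : ∀ {u w v} (e : Edge G) → Joins G e u w → Walk G w v → Walk G u v

module _ {G : SignedGraph} where

  edgesOf : ∀ {u v} → Walk G u v → List (Edge G)
  edgesOf []           = []
  edgesOf (step e _ p) = e ∷ edgesOf p

  verticesOf : ∀ {u v} → Walk G u v → List (Vertex G)
  verticesOf {u} []    = u ∷ []
  verticesOf {u} (step e _ p) = u ∷ verticesOf p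

  -- all vertices except the final one (for a closed walk: its vertex set)
  initVertices : ∀ {u v} → Walk G u v → List (Vertex G)
  initVertices []               = []
  initVertices {u} (step e _ p) = u ∷ initVertices p

  interior : ∀ {u v} → Walk G u v → List (Vertex G)
  interior []           = []
  interior (step e _ p) = initVertices p

  isNegative : ∀ {u v} → Walk G u v → Bool
  isNegative p = foldr _xor_ false (map (negative G) (edgesOf p))

SignConnectedVertices : (G : SignedGraph) → Vertex G → Vertex G → Set
SignConnectedVertices G u v =
  u ≡ v ⊎ ((Σ (Walk G u v) λ p → isNegative p ≡ false)
         × (Σ (Walk G u v) λ p → isNegative p ≡ true))

SignConnected : SignedGraph → Set
SignConnected G = ∀ u v → SignConnectedVertices G u v

-- G − x is sign connected: chains of G − x are exactly the chains of G
-- not visiting x.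
SignConnectedMinus : (G : SignedGraph) → Vertex G → Set
SignConnectedMinus G x = ∀ u v → u ≢ x → v ≢ x →
  u ≡ v ⊎ ((Σ (Walk G u v) λ p → x ∉ verticesOf p × isNegative p ≡ false)
         × (Σ (Walk G u v) λ p → x ∉ verticesOf p × isNegative p ≡ true))

SignArticulationVertex : (G : SignedGraph) → Vertex G → Set
SignArticulationVertex G x = ¬ SignConnectedMinus G x

SignBlock : SignedGraph → Set
SignBlock G = SignConnected G × (∀ x → ¬ SignArticulationVertex G x)

ChainFromTo : (G : SignedGraph) → Edge G → Edge G → ∀ {u v} → Walk G u v → Set
ChainFromTo G e f p = head (edgesOf p) ≡ just e × last (edgesOf p) ≡ just f

ArticulationVertex : (G : SignedGraph) → Vertex G → Set
ArticulationVertex G v = Σ (Edge G) λ e → Σ (Edge G) λ f →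
  ∀ {a b} (p : Walk G a b) → ChainFromTo G e f p → v ∈ interior p

IsBlock : SignedGraph → Set
IsBlock G = ∀ v → ¬ ArticulationVertex G v

-- an (elementary) cycle: a closed chain of length ≥ 1 with distinct edges
-- and distinct vertices; a loop is a cycle of length 1
record Cycle (G : SignedGraph) : Set where
  field
    base      : Vertex G
    walk      : Walk G base base
    nonempty  : edgesOf walk ≢ []
    edgesUniq : Unique (edgesOf walk)
    vertsUniq : Unique (initVertices walk)

open Cycle public

cycleVertices : ∀ {G} → Cycle G → List (Vertex G)
cycleVertices C = initVertices (walk C)

NegativeCycle : ∀ {G} → Cycle G → Set
NegativeCycle C = isNegative (walk C) ≡ true

VertexDisjoint : ∀ {G} → Cycle G → Cycle G → Set
VertexDisjoint {G} C D = ∀ (w : Vertex G) → w ∈ cycleVertices C → w ∉ cycleVertices D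

module Submission where

-- Let x be a vertex.  Being disjoint, the two negative cycles cannot
-- both pass through x, so some negative cycle K avoids x.  Because the
-- underlying graph is a block, G − x is connected: any two vertices u, v ≠ x
-- are joined by chains P (from u to K) and Q (from K to v) avoiding x.  Then
-- P·Q and P·K·Q are chains of G − x from u to v of opposite signs, so G − x
-- is sign connected.
--
-- Constructively, "x is not an articulation vertex" only says that it is
-- impossible for every chain between two edges to pass through x, so the
-- connectivity of G − x is obtained under a double negation.  This is all
-- we need, since "x is not a sign articulation vertex" is itself a negation.

open import Level using (0ℓ)
open import Data.Product using (Σ; _×_; _,_)
open import Data.Fin using (Fin; zero; suc; _≟_)
open import Data.Nat using (zero; suc)
open import Data.Bool using (true; false; _xor_; not)
open import Data.Bool.Properties using (xor-assoc; true-xor; not-distribʳ-xor)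
open import Data.Sum using (_⊎_; inj₁; inj₂)
open import Data.Maybe using (just)
open import Data.List using ([]; last)
open import Data.List.Relation.Unary.All using (All; []; _∷_)
open import Data.List.Relation.Unary.Any using (here; there; any?)
open import Data.List.Relation.Unary.All.Properties using (All¬⇒¬Any; ¬Any⇒All¬)
open import Data.List.Membership.Propositional using (_∈_; _∉_)
open import Data.Empty using (⊥-elim)
open import Effect.Monad using (RawMonad)
open import Relation.Nullary using (¬_; yes; no)
open import Relation.Nullary.Negation using (¬¬-Monad)
open import Relation.Binary.PropositionalEquality
  using (_≡_; _≢_; refl; sym; cong; module ≡-Reasoning)
open import Defs

open RawMonad (¬¬-Monad {0ℓ}) using (_>>=_; return)

¬¬-∀Fin : ∀ {n} {P : Fin n → Set} → (∀ i → ¬ ¬ P i) → ¬ ¬ (∀ i → P i)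
¬¬-∀Fin {zero}      _ = return (λ ())
¬¬-∀Fin {suc n} {P} h = do
  p₀ ← h zero
  ps ← ¬¬-∀Fin {n} {λ i → P (suc i)} (λ i → h (suc i))
  return λ { zero → p₀ ; (suc i) → ps i }

¬¬-→ : ∀ {A B : Set} → (A → ¬ ¬ B) → ¬ ¬ (A → B)
¬¬-→ h k = k (λ a → ⊥-elim (h a (λ b → k (λ _ → b))))

module _ {G : SignedGraph} where

  Incident : Edge G → Vertex G → Set
  Incident e u = Σ (Vertex G) λ w → Joins G e u w

  incident-endpoint : ∀ {e u a w} → Incident e u → Joins G e a w → u ≡ a ⊎ u ≡ w
  incident-endpoint (_ , inj₁ refl) (inj₁ refl) = inj₁ refl
  incident-endpoint (_ , inj₁ refl) (inj₂ refl) = inj₂ refl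
  incident-endpoint (_ , inj₂ refl) (inj₁ refl) = inj₂ refl
  incident-endpoint (_ , inj₂ refl) (inj₂ refl) = inj₁ refl

  Joins-sym : ∀ {e a w} → Joins G e a w → Joins G e w a
  Joins-sym (inj₁ p) = inj₂ p
  Joins-sym (inj₂ p) = inj₁ p

  -- In a sign-connected graph with at least two vertices every vertex lies
  -- on an edge (the first edge of a chain to another vertex).
  incidentEdge : SignConnected G → ∀ {u v} → u ≢ v → Σ (Edge G) λ e → Incident e u
  incidentEdge sc {u} {v} u≢v with sc u v
  ... | inj₁ u≡v                          = ⊥-elim (u≢v u≡v)
  ... | inj₂ ((step e j _ , _) , _)      = e , _ , j
  ... | inj₂ (([] , _) , _)              = ⊥-elim (u≢v refl)

  _++ʷ_ : ∀ {a b c} → Walk G a b → Walk G b c → Walk G a c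
  []           ++ʷ q = q
  step e j p   ++ʷ q = step e j (p ++ʷ q)

  isNegative-++ʷ : ∀ {a b c} (p : Walk G a b) (q : Walk G b c) →
    isNegative (p ++ʷ q) ≡ isNegative p xor isNegative q
  isNegative-++ʷ []           q = refl
  isNegative-++ʷ (step e j p) q = begin
    negative G e xor isNegative (p ++ʷ q)
      ≡⟨ cong (negative G e xor_) (isNegative-++ʷ p q) ⟩
    negative G e xor (isNegative p xor isNegative q)
      ≡⟨ xor-assoc (negative G e) (isNegative p) (isNegative q) ⟨
    (negative G e xor isNegative p) xor isNegative q ∎
    where open ≡-Reasoning

  detour-flips-sign : ∀ {u c v} (p : Walk G u c) (k : Walk G c c) (q : Walk G c v) →
    isNegative k ≡ true →
    isNegative (p ++ʷ (k ++ʷ q)) ≡ not (isNegative (p ++ʷ q))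
  detour-flips-sign p k q k⁻ = begin
    isNegative (p ++ʷ (k ++ʷ q))
      ≡⟨ isNegative-++ʷ p (k ++ʷ q) ⟩
    isNegative p xor isNegative (k ++ʷ q)
      ≡⟨ cong (isNegative p xor_) (isNegative-++ʷ k q) ⟩
    isNegative p xor (isNegative k xor isNegative q)
      ≡⟨ cong (λ s → isNegative p xor (s xor isNegative q)) k⁻ ⟩
    isNegative p xor (true xor isNegative q)
      ≡⟨ cong (isNegative p xor_) (true-xor (isNegative q)) ⟩
    isNegative p xor not (isNegative q)
      ≡⟨ not-distribʳ-xor (isNegative p) (isNegative q) ⟨
    not (isNegative p xor isNegative q)
      ≡⟨ cong not (isNegative-++ʷ p q) ⟨
    not (isNegative (p ++ʷ q)) ∎
    where open ≡-Reasoning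

  verticesOf-init : ∀ {a c y} (p : Walk G a c) →
    y ∈ verticesOf p → y ∈ initVertices p ⊎ y ≡ c
  verticesOf-init []           (here y≡c) = inj₂ y≡c
  verticesOf-init (step e j p) (here y≡a) = inj₁ (here y≡a)
  verticesOf-init (step e j p) (there y∈p) with verticesOf-init p y∈p
  ... | inj₁ y∈init = inj₁ (there y∈init)
  ... | inj₂ y≡c    = inj₂ y≡c

  closed-verticesOf : ∀ {c y} (p : Walk G c c) → edgesOf p ≢ [] →
    y ∈ verticesOf p → y ∈ initVertices p
  closed-verticesOf []           nonempty _   = ⊥-elim (nonempty refl)
  closed-verticesOf (step e j p) _        y∈p with verticesOf-init (step e j p) y∈p
  ... | inj₁ y∈init = y∈init
  ... | inj₂ refl   = here refl

  module Avoiding (x : Vertex G) where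

    -- the chain p does not visit x, i.e. it is a chain of G − x
    Avoids : ∀ {a b} → Walk G a b → Set
    Avoids p = All (x ≢_) (verticesOf p)

    Path : Vertex G → Vertex G → Set
    Path u v = Σ (Walk G u v) Avoids

    ++ʷ-avoids : ∀ {a b c} (p : Walk G a b) (q : Walk G b c) →
      Avoids p → Avoids q → Avoids (p ++ʷ q)
    ++ʷ-avoids []           q _         q̸ = q̸
    ++ʷ-avoids (step e j p) q (a̸ ∷ p̸) q̸ = a̸ ∷ ++ʷ-avoids p q p̸ q̸

    avoids-start : ∀ {a b} (p : Walk G a b) → Avoids p → x ≢ a
    avoids-start []           (a̸ ∷ _) = a̸
    avoids-start (step _ _ _) (a̸ ∷ _) = a̸

    Path-refl : ∀ {a} → x ≢ a → Path a a
    Path-refl a̸ = [] , a̸ ∷ []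

    Path-trans : ∀ {a b c} → Path a b → Path b c → Path a c
    Path-trans (p , p̸) (q , q̸) = p ++ʷ q , ++ʷ-avoids p q p̸ q̸

    Path-edge : ∀ {e a w} → Joins G e a w → x ≢ a → x ≢ w → Path a w
    Path-edge {e} j a̸ w̸ = step e j [] , a̸ ∷ w̸ ∷ []

    path-to-last : ∀ {w b f c} (q : Walk G w b) → last (edgesOf q) ≡ just f →
      All (x ≢_) (initVertices q) → Incident f c → x ≢ c → Path w c
    path-to-last [] ()
    path-to-last (step g j []) refl (w̸ ∷ []) f∋c c̸ with incident-endpoint f∋c j
    ... | inj₁ refl = Path-refl w̸
    ... | inj₂ refl = Path-edge j w̸ c̸
    path-to-last (step g j q@(step _ _ _)) q-last (w̸ ∷ q̸@(w₂̸ ∷ _)) f∋c c̸ =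
      Path-trans (Path-edge j w̸ w₂̸) (path-to-last q q-last q̸ f∋c c̸)

    path-from-chain : ∀ {a b e f u c} (p : Walk G a b) → ChainFromTo G e f p →
      All (x ≢_) (interior p) → Incident e u → Incident f c →
      x ≢ u → x ≢ c → Path u c
    path-from-chain [] (() , _)
    path-from-chain (step g j []) (refl , refl) _ e∋u f∋c u̸ c̸
      with incident-endpoint e∋u j | incident-endpoint f∋c j
    ... | inj₁ refl | inj₁ refl = Path-refl u̸
    ... | inj₁ refl | inj₂ refl = Path-edge j u̸ c̸
    ... | inj₂ refl | inj₂ refl = Path-refl u̸
    ... | inj₂ refl | inj₁ refl = Path-edge (Joins-sym j) u̸ c̸
    path-from-chain (step g j q@(step _ _ _)) (refl , q-last) q̸@(w̸ ∷ _) e∋u f∋c u̸ c̸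
      with incident-endpoint e∋u j
    ... | inj₁ refl = Path-trans (Path-edge j u̸ w̸) (path-to-last q q-last q̸ f∋c c̸)
    ... | inj₂ refl = path-to-last q q-last q̸ f∋c c̸

    -- If x is not an articulation vertex, it cannot be that every chain
    -- between an edge at u and an edge at c passes through x; such a chain
    -- avoiding x yields a path of G − x between u and c.
    path-between-edges : ¬ ArticulationVertex G x → ∀ {u c} (e f : Edge G) →
      Incident e u → Incident f c → x ≢ u → x ≢ c → ¬ ¬ Path u c
    path-between-edges notArt e f e∋u f∋c u̸ c̸ noPath =
      notArt (e , f , throughX)
      where
      throughX : ∀ {a b} (p : Walk G a b) → ChainFromTo G e f p → x ∈ interior p
      throughX p chain with any? (x ≟_) (interior p)
      ... | yes x∈p = x∈p
      ... | no  x∉p =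
        ⊥-elim (noPath (path-from-chain p chain (¬Any⇒All¬ _ x∉p) e∋u f∋c u̸ c̸))

    G-x-connected : SignConnected G → ¬ ArticulationVertex G x →
      ∀ {u c} → x ≢ u → x ≢ c → ¬ ¬ Path u c
    G-x-connected sc notArt {u} {c} u̸ c̸ with u ≟ c
    ... | yes refl = return (Path-refl u̸)
    ... | no  u≢c  with incidentEdge sc u≢c | incidentEdge sc (λ c≡u → u≢c (sym c≡u))
    ... | e , e∋u | f , f∋c = path-between-edges notArt e f e∋u f∋c u̸ c̸

    opposite-signs : ∀ {u v} (p q : Walk G u v) → Avoids p → Avoids q →
      isNegative q ≡ not (isNegative p) →
      (Σ (Walk G u v) λ r → x ∉ verticesOf r × isNegative r ≡ false)
      × (Σ (Walk G u v) λ r → x ∉ verticesOf r × isNegative r ≡ true)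
    opposite-signs p q p̸ q̸ q-sign with isNegative p in p-sign
    ... | false = (p , All¬⇒¬Any p̸ , p-sign) , (q , All¬⇒¬Any q̸ , q-sign)
    ... | true  = (q , All¬⇒¬Any q̸ , q-sign) , (p , All¬⇒¬Any p̸ , p-sign)

    -- A negative cycle K avoiding x makes G − x sign connected: join u to K
    -- and K to v inside G − x, and go around K or not.
    G-x-signConnected : SignConnected G → ¬ ArticulationVertex G x →
      (K : Cycle G) → NegativeCycle K → x ∉ cycleVertices K →
      ¬ ¬ SignConnectedMinus G x
    G-x-signConnected sc notArt K K⁻ x∉K =
      ¬¬-∀Fin λ u → ¬¬-∀Fin λ v → ¬¬-→ λ u≢x → ¬¬-→ λ v≢x → do
        (p , p̸) ← G-x-connected sc notArt (λ x≡u → u≢x (sym x≡u)) b̸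
        (q , q̸) ← G-x-connected sc notArt b̸ (λ x≡v → v≢x (sym x≡v))
        return (inj₂ (opposite-signs (p ++ʷ q) (p ++ʷ (walk K ++ʷ q))
          (++ʷ-avoids p q p̸ q̸)
          (++ʷ-avoids p (walk K ++ʷ q) p̸ (++ʷ-avoids (walk K) q K̸ q̸))
          (detour-flips-sign p (walk K) q K⁻)))
      where
      K̸ : Avoids (walk K)
      K̸ = ¬Any⇒All¬ _ (λ x∈K → x∉K (closed-verticesOf (walk K) (nonempty K) x∈K))
      b̸ : x ≢ base K
      b̸ = avoids-start (walk K) K̸

open Avoiding using (G-x-signConnected)

proposition3p13 : (G : SignedGraph) → SignConnected G → IsBlock G →
    (Σ (Cycle G) λ C → Σ (Cycle G) λ D →
        NegativeCycle C × NegativeCycle D × VertexDisjoint C D) →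
    SignBlock G
proposition3p13 G sc block (C , D , C⁻ , D⁻ , disjoint) = sc , notSignArticulation
  where
  -- x misses C or, lying on C, misses D; either way a negative cycle avoids x.
  notSignArticulation : ∀ x → ¬ SignArticulationVertex G x
  notSignArticulation x with any? (x ≟_) (cycleVertices C)
  ... | yes x∈C = G-x-signConnected x sc (block x) D D⁻ (disjoint x x∈C)
  ... | no  x∉C = G-x-signConnected x sc (block x) C C⁻ x∉C
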